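{- Let $\varphi$ be a quantifier-free conjunction of equality literals, $G=\langle N,E,L,\mathit{root}\rangle=\mathit{egraph}(\varphi)$, and $r$ an admissible representative function for $G$. Then for every node $n\in N$, $\varphi\models\mathit{ntt}(n)\approx\mathit{toexpr}(n,r)$.
   Context: Entailment $\models$ is that of the theory of equality with uninterpreted functions. An egraph is $G=\langle N,E,L,\mathit{root}\rangle$ with $\langle N,E\rangle$ a finite DAG with ordered successors ($n[i]$ the $i$-th child, $\deg(n)$ out-degree), $L$ labelling nodes by function symbols or variables, and $\rho_{\mathit{root}}=\{(n,n')\mid\mathit{root}(n)=\mathit{root}(n')\}$ an equivalence relation closed under congruence. $\mathit{class}(n)=\rho_{\mathit{root}}(n)$. $\mathit{ntt}(n)=L(n)$ if $\deg(n)=0$ and $L(n)(\mathit{ntt}(n[1]),\dots,\mathit{ntt}(n[\deg(n)]))$ otherwise. $\mathit{egraph}(\varphi)$ has one node per subterm of $\varphi$ and $\rho_{\mathit{root}}$ is the congruence closure of the equalities of $\varphi$. For $r:N\to N$, $\mathit{toexpr}(n,r)=L(n)$ if $\deg(n)=0$ and $L(n)(\mathit{toexpr}(r(n[1]),r),\dots,\mathit{toexpr}(r(n[\deg(n)]),r))$ otherwise. $r$ is admissible for $G$ if (a) $r(n)\in\mathit{class}(n)$ and $r$ is constant on each class, (b) $\rho_{\mathit{root}}=\{(n,n')\mid r(n)=r(n')\}$, and (c) the graph $G_r=\langle N,E_r\rangle$, $E_r=\{(n,r(c))\mid c\text{ a child of }n\}$, is acyclic. -}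

module Defs where

open import Data.Nat using (ℕ)
open import Data.List using (List; []; _∷_; map)
open import Data.List.Membership.Propositional using (_∈_)
open import Data.List.Relation.Unary.All using (All)
open import Data.List.Relation.Unary.Any using (Any)
open import Data.List.Relation.Binary.Pointwise using (Pointwise)
open import Data.Product using (Σ; _×_; ∃; ∃-syntax)
open import Data.Sum using (_⊎_)
open import Relation.Nullary using (¬_)
open import Relation.Binary.PropositionalEquality using (_≡_)
open import Relation.Binary.Construct.Closure.Transitive using (TransClosure)
open import Function.Bundles using (_⇔_)

-- Terms over labels (function symbols and variables), labels = ℕ.
-- A variable / constant is a label applied to the empty argument list.

Label : Set
Label = ℕ

data Term : Set where
  app : Label → List Term → Term

data Lit : Set where
  _≈ₗ_ : Term → Term → Lit
  _≉ₗ_ : Term → Term → Lit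

Formula : Set
Formula = List Lit

mutual
  eval : {D : Set} → (Label → List D → D) → Term → D
  eval I (app f ts) = I f (evals I ts)

  evals : {D : Set} → (Label → List D → D) → List Term → List D
  evals I []       = []
  evals I (t ∷ ts) = eval I t ∷ evals I ts

Holds : {D : Set} → (Label → List D → D) → Lit → Set
Holds I (s ≈ₗ t) = eval I s ≡ eval I t
Holds I (s ≉ₗ t) = ¬ (eval I s ≡ eval I t)

_⊨_≈_ : Formula → Term → Term → Set₁
φ ⊨ s ≈ t = (D : Set) (I : Label → List D → D) →
            All (Holds I) φ → eval I s ≡ eval I t

-- egraph(φ): nodes are the (distinct) subterms of φ; ntt(n) = n;
-- L(app f ts) = f; the ordered children of app f ts are ts.

data _⊑_ : Term → Term → Set where
  here : ∀ {t} → t ⊑ t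
  arg  : ∀ {t u f ts} → u ∈ ts → t ⊑ u → t ⊑ app f ts

lhs rhs : Lit → Term
lhs (s ≈ₗ t) = s
lhs (s ≉ₗ t) = s
rhs (s ≈ₗ t) = t
rhs (s ≉ₗ t) = t

Node : Formula → Term → Set
Node φ n = Any (λ l → n ⊑ lhs l ⊎ n ⊑ rhs l) φ

ntt : Term → Term
ntt n = n

Child : Term → Term → Set
Child (app f ts) c = c ∈ ts

-- ρ_root of egraph(φ): the congruence closure on N of the equalities of φ
data CC (φ : Formula) : Term → Term → Set where
  ax    : ∀ {s t} → (s ≈ₗ t) ∈ φ → CC φ s t
  rfl   : ∀ {t} → Node φ t → CC φ t t
  sym   : ∀ {s t} → CC φ s t → CC φ t s
  trans : ∀ {s t u} → CC φ s t → CC φ t u → CC φ s u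
  cong  : ∀ {f ss ts} → Node φ (app f ss) → Node φ (app f ts) →
          Pointwise (CC φ) ss ts → CC φ (app f ss) (app f ts)

-- Representative functions r : N → N (given as a function on terms;
-- only its values on nodes matter).

Edgeʳ : Formula → (Term → Term) → Term → Term → Set
Edgeʳ φ r n m = Node φ n × ∃[ c ] (Child n c × m ≡ r c)

Acyclic : {A : Set} → (A → A → Set) → Set
Acyclic {A} E = ∀ (n : A) → ¬ TransClosure E n n

record Admissible (φ : Formula) (r : Term → Term) : Set where
  field
    inClass  : ∀ n → Node φ n → CC φ n (r n)
    constant : ∀ n n' → Node φ n → Node φ n' → CC φ n n' → r n ≡ r n'
    kernel   : ∀ n n' → Node φ n → Node φ n' → (CC φ n n' ⇔ (r n ≡ r n'))
    acyclic  : Acyclic (Edgeʳ φ r)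

-- toexpr(n, r), given as the graph of the recursive definition
-- (its termination relies on acyclicity of G_r):
--   toexpr(n,r) = L(n)(toexpr(r(n[1]),r), …, toexpr(r(n[deg n]),r))

data ToExpr (r : Term → Term) : Term → Term → Set where
  node : ∀ {f ts us} →
         Pointwise (λ c u → ToExpr r (r c) u) ts us →
         ToExpr r (app f ts) (app f us)

{-# OPTIONS --safe #-}
-- Existence: toexpr(n, r) recurses along the edges of G_r, and an acyclic relation
-- on the finitely many nodes of egraph(φ) is well-founded, so the recursion is
-- accessible from every node.
-- Soundness: toexpr(n, r) differs from n only in that each child c is replaced by
-- (the expression of) r(c), and r(c) is congruent to c; the congruence closure of
-- the equalities of φ holds in every model of φ.
module Submission where

open import Defs
open import Data.Nat using (_<_)
open import Data.Nat.Induction using (<-wellFounded)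
open import Data.Nat.Properties using () renaming (_≟_ to _≟ℕ_)
open import Data.List using (List; []; _∷_; _++_; length; filter)
open import Data.List.Properties using (filter-notAll)
open import Data.List.Membership.Propositional using (_∈_)
open import Data.List.Membership.Propositional.Properties using (∈-++⁺ˡ; ∈-++⁺ʳ; ∈-filter⁺)
open import Data.List.Relation.Unary.Any as Any using (here; there)
open import Data.List.Relation.Unary.All as All using (All)
open import Data.List.Relation.Binary.Pointwise using (Pointwise; []; _∷_)
open import Data.Product using (_×_; ∃; ∃-syntax; _,_; proj₁; proj₂)
import Data.Product as Product
open import Data.Sum as Sum using (inj₁; inj₂)
open import Function using (flip; _∘_)
open import Induction.WellFounded using (Acc; acc)
open import Level using (0ℓ)
open import Relation.Binary using (Rel)
open import Relation.Binary.Definitions using (DecidableEquality)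
open import Relation.Binary.PropositionalEquality as ≡ using (_≡_; refl)
open import Relation.Binary.Construct.Closure.Transitive using (TransClosure; [_]; _∷_)
open import Relation.Nullary using (yes; no; ¬?)

mutual
  _≟ₜ_ : DecidableEquality Term
  app f ts ≟ₜ app g us with f ≟ℕ g | ts ≟ₜₛ us
  ... | yes refl | yes refl = yes refl
  ... | no f≢g   | _        = no λ { refl → f≢g refl }
  ... | yes _    | no ts≢us = no λ { refl → ts≢us refl }

  _≟ₜₛ_ : DecidableEquality (List Term)
  []       ≟ₜₛ []       = yes refl
  []       ≟ₜₛ (_ ∷ _)  = no λ ()
  (_ ∷ _)  ≟ₜₛ []       = no λ ()
  (t ∷ ts) ≟ₜₛ (u ∷ us) with t ≟ₜ u | ts ≟ₜₛ us
  ... | yes refl | yes refl = yes refl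
  ... | no t≢u   | _        = no λ { refl → t≢u refl }
  ... | yes _    | no ts≢us = no λ { refl → ts≢us refl }

pointwise-choice : {A B : Set} {R : A → B → Set} (xs : List A) →
                   (∀ {x} → x ∈ xs → ∃ (R x)) → ∃ (Pointwise R xs)
pointwise-choice []       choose = [] , []
pointwise-choice (x ∷ xs) choose
  with y , xRy ← choose (here refl) | ys , xsRys ← pointwise-choice xs (choose ∘ there)
  = y ∷ ys , xRy ∷ xsRys

-- Induction on the length of R: after an edge x → y, the list R without y still
-- covers everything reachable from y, because by acyclicity y is not among it.
module _ {A : Set} (_≟_ : DecidableEquality A) {E : Rel A 0ℓ} (acyclic : Acyclic E) where

  acc-if-reach-finite : (R : List A) {x : A} → (∀ {y} → TransClosure E x y → y ∈ R) →
                        Acc (flip E) x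
  acc-if-reach-finite R = go R (<-wellFounded (length R))
    where
    go : (R : List A) → Acc _<_ (length R) → ∀ {x} →
         (∀ {y} → TransClosure E x y → y ∈ R) → Acc (flip E) x
    go R (acc shorter) reach⊆R = acc λ {y} x→y →
      go (filter (¬? ∘ (_≟ y)) R)
         (shorter (filter-notAll (¬? ∘ (_≟ y)) R
                     (Any.map (λ y≡z z≢y → z≢y (≡.sym y≡z)) (reach⊆R [ x→y ]))))
         (λ {z} y→⁺z → ∈-filter⁺ (¬? ∘ (_≟ y)) (reach⊆R (x→y ∷ y→⁺z))
                                     (λ { refl → acyclic y y→⁺z }))

mutual
  subterms : Term → List Term
  subterms (app f ts) = app f ts ∷ subtermsᴸ ts

  subtermsᴸ : List Term → List Term
  subtermsᴸ []       = []
  subtermsᴸ (t ∷ ts) = subterms t ++ subtermsᴸ ts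

∈-subtermsᴸ : ∀ {s u} ts → u ∈ ts → s ∈ subterms u → s ∈ subtermsᴸ ts
∈-subtermsᴸ (t ∷ ts) (here refl) s∈ = ∈-++⁺ˡ s∈
∈-subtermsᴸ (t ∷ ts) (there u∈)  s∈ = ∈-++⁺ʳ (subterms t) (∈-subtermsᴸ ts u∈ s∈)

⊑⇒∈subterms : ∀ {s t} → s ⊑ t → s ∈ subterms t
⊑⇒∈subterms {app _ _} here           = here refl
⊑⇒∈subterms (arg {ts = ts} u∈ s⊑u) = there (∈-subtermsᴸ ts u∈ (⊑⇒∈subterms s⊑u))

⊑-trans : ∀ {s t u} → s ⊑ t → t ⊑ u → s ⊑ u
⊑-trans s⊑t here          = s⊑t
⊑-trans s⊑t (arg v∈ t⊑v) = arg v∈ (⊑-trans s⊑t t⊑v)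

nodes : Formula → List Term
nodes []      = []
nodes (l ∷ φ) = subterms (lhs l) ++ subterms (rhs l) ++ nodes φ

Node⇒∈nodes : ∀ {φ n} → Node φ n → n ∈ nodes φ
Node⇒∈nodes         (here (inj₁ n⊑s)) = ∈-++⁺ˡ (⊑⇒∈subterms n⊑s)
Node⇒∈nodes {l ∷ φ} (here (inj₂ n⊑t)) = ∈-++⁺ʳ (subterms (lhs l)) (∈-++⁺ˡ (⊑⇒∈subterms n⊑t))
Node⇒∈nodes {l ∷ φ} (there nd) =
  ∈-++⁺ʳ (subterms (lhs l)) (∈-++⁺ʳ (subterms (rhs l)) (Node⇒∈nodes nd))

child-Node : ∀ {φ f ts c} → Node φ (app f ts) → c ∈ ts → Node φ c
child-Node nd c∈ = Any.map (Sum.map (⊑-trans (arg c∈ here)) (⊑-trans (arg c∈ here))) nd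

CC⇒Nodes : ∀ {φ s t} → CC φ s t → Node φ s × Node φ t
CC⇒Nodes (ax eq∈)          = Any.map (λ { refl → inj₁ here }) eq∈ ,
                             Any.map (λ { refl → inj₂ here }) eq∈
CC⇒Nodes (rfl nd)          = nd , nd
CC⇒Nodes (sym s~t)         = Product.swap (CC⇒Nodes s~t)
CC⇒Nodes (trans s~t t~u)   = proj₁ (CC⇒Nodes s~t) , proj₂ (CC⇒Nodes t~u)
CC⇒Nodes (cong nds ndt _)  = nds , ndt

module _ {φ : Formula} {r : Term → Term} (adm : Admissible φ r) where
  open Admissible adm

  rep-Node : ∀ {n} → Node φ n → Node φ (r n)
  rep-Node {n} nd = proj₂ (CC⇒Nodes (inClass n nd))

  edge-Node : ∀ {n m} → Edgeʳ φ r n m → Node φ m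
  edge-Node {app _ _} (nd , c , c∈ , refl) = rep-Node (child-Node nd c∈)

  reach-Node : ∀ {n m} → TransClosure (Edgeʳ φ r) n m → Node φ m
  reach-Node [ n→m ]    = edge-Node n→m
  reach-Node (_ ∷ n→⁺m) = reach-Node n→⁺m

  Edgeʳ-acc : ∀ n → Acc (flip (Edgeʳ φ r)) n
  Edgeʳ-acc n = acc-if-reach-finite _≟ₜ_ acyclic (nodes φ) (Node⇒∈nodes ∘ reach-Node)

  toExpr-exists : ∀ {n} → Node φ n → Acc (flip (Edgeʳ φ r)) n → ∃ (ToExpr r n)
  toExpr-exists {app f ts} nd (acc rec) =
    Product.map (app f) node (pointwise-choice ts λ c∈ →
      toExpr-exists (rep-Node (child-Node nd c∈)) (rec (nd , _ , c∈ , refl)))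

module _ {φ : Formula} {D : Set} (I : Label → List D → D) (⊨φ : All (Holds I) φ) where

  mutual
    eval-CC : ∀ {s t} → CC φ s t → eval I s ≡ eval I t
    eval-CC (ax eq∈)             = All.lookup ⊨φ eq∈
    eval-CC (rfl _)              = refl
    eval-CC (sym s~t)            = ≡.sym (eval-CC s~t)
    eval-CC (trans s~t t~u)      = ≡.trans (eval-CC s~t) (eval-CC t~u)
    eval-CC (cong {f} _ _ ss~ts) = ≡.cong (I f) (evals-CC ss~ts)

    evals-CC : ∀ {ss ts} → Pointwise (CC φ) ss ts → evals I ss ≡ evals I ts
    evals-CC []            = refl
    evals-CC (s~t ∷ ss~ts) = ≡.cong₂ _∷_ (eval-CC s~t) (evals-CC ss~ts)

  module _ {r : Term → Term} (adm : Admissible φ r) where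
    open Admissible adm

    mutual
      eval-toExpr : ∀ {n t} → Node φ n → ToExpr r n t → eval I n ≡ eval I t
      eval-toExpr {app f ts} nd (node ts↦us) = ≡.cong (I f) (evals-toExpr (child-Node nd) ts↦us)

      evals-toExpr : ∀ {ts us} → (∀ {c} → c ∈ ts → Node φ c) →
                     Pointwise (λ c u → ToExpr r (r c) u) ts us → evals I ts ≡ evals I us
      evals-toExpr nds [] = refl
      evals-toExpr {c ∷ _} nds (c↦u ∷ cs↦us) =
        ≡.cong₂ _∷_ (≡.trans (eval-CC (inClass c (nds (here refl))))
                             (eval-toExpr (rep-Node adm (nds (here refl))) c↦u))
                    (evals-toExpr (nds ∘ there) cs↦us)

lemma5 : (φ : Formula) (r : Term → Term) → Admissible φ r →
         ∀ n → Node φ n →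
         (∃[ t ] ToExpr r n t) ×
         (∀ t → ToExpr r n t → φ ⊨ ntt n ≈ t)
lemma5 φ r adm n nd =
  toExpr-exists adm nd (Edgeʳ-acc adm n) ,
  λ t n↦t D I ⊨φ → eval-toExpr I ⊨φ adm nd n↦t
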